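{- Let $j\ge2$ be an integer, let $0<r\le2^{ -j}$, let $\mu=2^{ -j}+r$, and let $\mu^-,\mu^+$ be dyadic rationals with $0\le\mu^-\le\mu^+\le1$ and $\frac{\mu^-+\mu^+}{2}=\mu$. If $\mu^-\le r$, then $I[\mathcal{L}_{\mu^-,\mu^+}]\ge I[\mathcal{L}_\mu]+2\mu^-$. If instead $3r\le\mu^-\le\frac12\mu$, then $I[\mathcal{L}_{\mu^-,\mu^+}]\ge I[\mathcal{L}_\mu]+\frac23\mu^-$.
   Context: For $\mathcal{H}\subset\mathcal{P}([N])$, $\mathrm{Inf}_i[\mathcal{H}]$ is the probability, for $A$ uniform in $\mathcal{P}([N])$, that exactly one of $A$, $A\Delta\{i\}$ lies in $\mathcal{H}$, and $I[\mathcal{H}]=\sum_i\mathrm{Inf}_i[\mathcal{H}]$. The lexicographic order on $\mathcal{P}(X)$ is $S>T$ iff $\min(S\Delta T)\in S$. For a dyadic rational $\mu\in[0,1]$, $I[\mathcal{L}_\mu]$ denotes the total influence of the initial segment (largest sets) of the lexicographic order on $\mathcal{P}([m])$ of measure $\mu$, for any $m$ with $2^m\mu\in\mathbb{Z}$ (this does not depend on $m$). For dyadic rationals $\mu^-,\mu^+\in[0,1]$, $\mathcal{L}_{\mu^-,\mu^+}$ is the fractional lexicographic family of order 1 with value $\mu^+$ at $\{1\}$ and $\mu^-$ at $\varnothing$; it represents the family in $\mathcal{P}([m+1])$ (any $m$ with $2^m\mu^\pm\in\mathbb{Z}$) whose slice $\{S\setminus\{1\}:1\in S\}$ is the lexicographic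 initial segment of $\mathcal{P}(\{2,\dots,m+1\})$ of measure $\mu^+$ and whose slice $\{S:1\notin S\}$ is the lexicographic initial segment of measure $\mu^-$; $I[\mathcal{L}_{\mu^-,\mu^+}]$ is the total influence of this family (independent of $m$). -}

module Defs where

open import Data.Bool using (Bool; true; false; not; _xor_; if_then_else_)
open import Data.Nat as ℕ using (ℕ; zero; suc; _^_; _<ᵇ_)
open import Data.Nat.Properties using (m^n≢0)
open import Data.Fin using (Fin; zero; suc)
open import Data.Vec using (Vec; []; _∷_; updateAt)
open import Data.List using (List; []; _∷_; _++_; map; filter; length; foldr)
open import Data.Integer using (+_)
open import Data.Rational using (ℚ; _/_; _+_; 0ℚ)
open import Relation.Nullary.Decidable using (does)
open import Relation.Binary.PropositionalEquality using (_≡_; refl)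
open import Data.Bool.Properties using (T?)
open import Data.Bool using (T)

-- A family 𝓗 ⊆ 𝓟([N]) given by its (decidable) indicator on subsets,
-- a subset of [N] being its characteristic vector (index 0 = element 1).
Family : ℕ → Set
Family N = Vec Bool N → Bool

allSubsets : (N : ℕ) → List (Vec Bool N)
allSubsets zero = [] ∷ []
allSubsets (suc N) = map (true ∷_) (allSubsets N) ++ map (false ∷_) (allSubsets N)

count : {N : ℕ} → (Vec Bool N → Bool) → ℕ
count {N} P = length (filter (λ A → T? (P A)) (allSubsets N))

dy : ℕ → ℕ → ℚ
dy k m = (+ k) / (2 ^ m)
  where instance _ = m^n≢0 2 m

Inf : {N : ℕ} → Family N → Fin N → ℚ
Inf {N} H i = dy (count (λ A → H A xor H (updateAt A i not))) N

sumFin : (N : ℕ) → (Fin N → ℚ) → ℚ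
sumFin zero f = 0ℚ
sumFin (suc N) f = f zero + sumFin N (λ i → f (suc i))

I : {N : ℕ} → Family N → ℚ
I {N} H = sumFin N (Inf H)

lexGt : {N : ℕ} → Vec Bool N → Vec Bool N → Bool
lexGt [] [] = false
lexGt (true ∷ S) (false ∷ T) = true
lexGt (false ∷ S) (true ∷ T) = false
lexGt (true ∷ S) (true ∷ T) = lexGt S T
lexGt (false ∷ S) (false ∷ T) = lexGt S T

-- initial segment of the lex order on 𝓟([m]) consisting of the k largest sets
-- (measure k / 2^m): S belongs iff fewer than k sets are lex-greater than S
lexSeg : (m k : ℕ) → Family m
lexSeg m k S = count (λ T → lexGt T S) <ᵇ k

-- fractional lexicographic family of order 1 in 𝓟([m+1]):
-- slice containing element 1 is lexSeg of size b (measure μ⁺ = b/2^m),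
-- slice avoiding element 1 is lexSeg of size a (measure μ⁻ = a/2^m),
-- both on the ground set {2,…,m+1} in its natural order
fracLex : (m a b : ℕ) → Family (suc m)
fracLex m a b (true ∷ S) = lexSeg m b S
fracLex m a b (false ∷ S) = lexSeg m a S

-- Scaling by 2^m turns every measure into a natural number: μ⁻ = a/2^m, μ⁺ = b/2^m, μ = k/2^m, r = c/2^m,
-- so a + b = 2k and k = 2^t + c with t = m − j. Counted with multiplicity 2, the edge boundary of the lex
-- initial segment of size k in the m-cube is 2mk − 4e(k), where e(k) is the number of cube edges among the
-- binary expansions of 0, …, k − 1, and splitting along the first coordinate gives the boundary of
-- L_{μ⁻,μ⁺} as 2(b − a) plus the boundaries of its two lex slices. With a + b = 2k this makes
-- I[L_{μ⁻,μ⁺}] − I[L_μ] = (e(a + b) − e(a) − e(b) − a)/2^(m−1), and both claims are lower bounds on this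
-- gap (a, resp. a/3). They follow from e(2^t + x) = e(2^t) + e(x) + x for x ≤ 2^t and the superadditivity
-- e(x) + e(y) + min(x, y) ≤ e(x + y), itself proved by pairing the halves ⌊x/2⌋, ⌈y/2⌉ and ⌈x/2⌉, ⌊y/2⌋.

module Submission where

module EdgesBelow where

  open import Data.Nat.Base
  open import Data.Nat.Properties
  open import Data.Nat.Induction using (<-wellFounded)
  open import Data.Nat.Solver using (module +-*-Solver)
  open import Data.Product.Base using (_×_; _,_; proj₁; proj₂)
  open import Data.Sum.Base using (_⊎_; inj₁; inj₂)
  open import Induction.WellFounded using (Acc; acc)
  open import Relation.Binary.PropositionalEquality
  open +-*-Solver using (solve; _:+_; _:*_; _:=_; con)

  -- edgesBelow n counts the cube edges among the binary expansions of 0, …, n − 1 (the first argument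
  -- of edgesBelowWithin is fuel): the evens 2i and the odds 2i + 1 form copies of the first ⌈n/2⌉ and
  -- ⌊n/2⌋ numbers, joined by the ⌊n/2⌋ edges {2i, 2i + 1}.
  edgesBelowWithin : ℕ → ℕ → ℕ
  edgesBelowWithin zero    _ = 0
  edgesBelowWithin (suc f) 0 = 0
  edgesBelowWithin (suc f) 1 = 0
  edgesBelowWithin (suc f) n@(suc (suc _)) =
    edgesBelowWithin f ⌊ n /2⌋ + edgesBelowWithin f ⌈ n /2⌉ + ⌊ n /2⌋

  edgesBelow : ℕ → ℕ
  edgesBelow n = edgesBelowWithin n n

  ⌈2+k/2⌉≤1+k : ∀ k → ⌈ 2 + k /2⌉ ≤ 1 + k
  ⌈2+k/2⌉≤1+k k = s≤s (⌈n/2⌉≤n k)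

  ⌊2+k/2⌋≤1+k : ∀ k → ⌊ 2 + k /2⌋ ≤ 1 + k
  ⌊2+k/2⌋≤1+k k = ≤-trans (⌊n/2⌋≤⌈n/2⌉ (2 + k)) (⌈2+k/2⌉≤1+k k)

  edgesBelowWithin-zero : ∀ f → edgesBelowWithin f 0 ≡ 0
  edgesBelowWithin-zero zero    = refl
  edgesBelowWithin-zero (suc f) = refl

  edgesBelowWithin-fuel : ∀ {f g} n → n ≤ f → n ≤ g → edgesBelowWithin f n ≡ edgesBelowWithin g n
  edgesBelowWithin-fuel {f} {g} zero _ _ = trans (edgesBelowWithin-zero f) (sym (edgesBelowWithin-zero g))
  edgesBelowWithin-fuel 1 (s≤s _) (s≤s _) = refl
  edgesBelowWithin-fuel n@(suc (suc k)) (s≤s k<f) (s≤s k<g) =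
    cong₂ (λ x y → x + y + ⌊ n /2⌋)
      (edgesBelowWithin-fuel ⌊ n /2⌋ (≤-trans (⌊2+k/2⌋≤1+k k) k<f) (≤-trans (⌊2+k/2⌋≤1+k k) k<g))
      (edgesBelowWithin-fuel ⌈ n /2⌉ (≤-trans (⌈2+k/2⌉≤1+k k) k<f) (≤-trans (⌈2+k/2⌉≤1+k k) k<g))

  edgesBelow-halves : ∀ n → edgesBelow n ≡ edgesBelow ⌊ n /2⌋ + edgesBelow ⌈ n /2⌉ + ⌊ n /2⌋
  edgesBelow-halves 0 = refl
  edgesBelow-halves 1 = refl
  edgesBelow-halves n@(suc (suc k)) =
    cong₂ (λ x y → x + y + ⌊ n /2⌋)
      (edgesBelowWithin-fuel ⌊ n /2⌋ (⌊2+k/2⌋≤1+k k) ≤-refl)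
      (edgesBelowWithin-fuel ⌈ n /2⌉ (⌈2+k/2⌉≤1+k k) ≤-refl)

  edgesBelow-double : ∀ n → edgesBelow (n + n) ≡ edgesBelow n + edgesBelow n + n
  edgesBelow-double n = begin
    edgesBelow (n + n)
      ≡⟨ edgesBelow-halves (n + n) ⟩
    edgesBelow ⌊ n + n /2⌋ + edgesBelow ⌈ n + n /2⌉ + ⌊ n + n /2⌋
      ≡⟨ cong₂ (λ u v → edgesBelow u + edgesBelow v + u) (sym (n≡⌊n+n/2⌋ n)) (sym (n≡⌈n+n/2⌉ n)) ⟩
    edgesBelow n + edgesBelow n + n ∎
    where open ≡-Reasoning

  halves-+ : ∀ x y →
    (⌊ x + y /2⌋ ≡ ⌊ x /2⌋ + ⌈ y /2⌉ × ⌈ x + y /2⌉ ≡ ⌈ x /2⌉ + ⌊ y /2⌋) ⊎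
    (⌊ x + y /2⌋ ≡ ⌈ x /2⌉ + ⌊ y /2⌋ × ⌈ x + y /2⌉ ≡ ⌊ x /2⌋ + ⌈ y /2⌉)
  halves-+ 0 y = inj₂ (refl , refl)
  halves-+ 1 y = inj₁ (refl , refl)
  halves-+ (suc (suc x)) y with halves-+ x y
  ... | inj₁ (p , q) = inj₁ (cong suc p , cong suc q)
  ... | inj₂ (p , q) = inj₂ (cong suc p , cong suc q)

  edgesBelow-+ : ∀ x y → edgesBelow (x + y) ≡
    edgesBelow (⌊ x /2⌋ + ⌈ y /2⌉) + edgesBelow (⌈ x /2⌉ + ⌊ y /2⌋) + ⌊ x + y /2⌋
  edgesBelow-+ x y with halves-+ x y
  ... | inj₁ (p , q) = trans (edgesBelow-halves (x + y))
    (cong₂ (λ u v → edgesBelow u + edgesBelow v + ⌊ x + y /2⌋) p q)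
  ... | inj₂ (p , q) = trans (edgesBelow-halves (x + y))
    (trans (cong₂ (λ u v → edgesBelow u + edgesBelow v + ⌊ x + y /2⌋) p q)
           (cong (_+ ⌊ x + y /2⌋) (+-comm (edgesBelow (⌈ x /2⌉ + ⌊ y /2⌋)) _)))

  ⊓-halves : ∀ x y → x ⊓ y + ⌊ x /2⌋ + ⌊ y /2⌋ ≤ ⌊ x /2⌋ ⊓ ⌈ y /2⌉ + ⌈ x /2⌉ ⊓ ⌊ y /2⌋ + ⌊ x + y /2⌋
  ⊓-halves 0 y = ≤-refl
  ⊓-halves (suc x) 0
    rewrite ⊓-zeroʳ ⌊ suc x /2⌋ | +-identityʳ x | +-identityʳ ⌊ suc x /2⌋ = ≤-refl
  ⊓-halves 1 1 = ≤-refl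
  ⊓-halves 1 (suc (suc y)) = s≤s (s≤s (⌊n/2⌋≤⌈n/2⌉ y))
  ⊓-halves (suc (suc x)) 1
    rewrite ⊓-zeroʳ ⌊ x /2⌋ | +-identityʳ ⌊ x /2⌋ | +-comm x 1 = s≤s (s≤s (⌊n/2⌋≤⌈n/2⌉ x))
  ⊓-halves (suc (suc x)) (suc (suc y)) = begin
    2 + x ⊓ y + (1 + ⌊ x /2⌋) + (1 + ⌊ y /2⌋)
      ≡⟨ solve 3 (λ m a b → con 2 :+ m :+ (con 1 :+ a) :+ (con 1 :+ b) := con 4 :+ (m :+ a :+ b))
               refl (x ⊓ y) ⌊ x /2⌋ ⌊ y /2⌋ ⟩
    4 + (x ⊓ y + ⌊ x /2⌋ + ⌊ y /2⌋)
      ≤⟨ +-monoʳ-≤ 4 (⊓-halves x y) ⟩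
    4 + (⌊ x /2⌋ ⊓ ⌈ y /2⌉ + ⌈ x /2⌉ ⊓ ⌊ y /2⌋ + ⌊ x + y /2⌋)
      ≡⟨ solve 3 (λ a b c → con 4 :+ (a :+ b :+ c) := (con 1 :+ a) :+ (con 1 :+ b) :+ (con 2 :+ c))
               refl (⌊ x /2⌋ ⊓ ⌈ y /2⌉) (⌈ x /2⌉ ⊓ ⌊ y /2⌋) ⌊ x + y /2⌋ ⟩
    1 + ⌊ x /2⌋ ⊓ ⌈ y /2⌉ + (1 + ⌈ x /2⌉ ⊓ ⌊ y /2⌋) + (2 + ⌊ x + y /2⌋)
      ≡⟨ cong (λ z → 1 + ⌊ x /2⌋ ⊓ ⌈ y /2⌉ + (1 + ⌈ x /2⌉ ⊓ ⌊ y /2⌋) + suc ⌊ z /2⌋)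
              (sym (trans (+-suc x (suc y)) (cong suc (+-suc x y)))) ⟩
    1 + ⌊ x /2⌋ ⊓ ⌈ y /2⌉ + (1 + ⌈ x /2⌉ ⊓ ⌊ y /2⌋) + (1 + ⌊ x + suc (suc y) /2⌋) ∎
    where open ≤-Reasoning

  edgesBelow-superadditive : ∀ x y → edgesBelow x + edgesBelow y + x ⊓ y ≤ edgesBelow (x + y)
  edgesBelow-superadditive x y = go x y (<-wellFounded (x + y))
    where
    e = edgesBelow
    go : ∀ x y → Acc _<_ (x + y) → e x + e y + x ⊓ y ≤ e (x + y)
    go zero y _ = ≤-reflexive (+-identityʳ (e y))
    go (suc x) zero _
      rewrite +-identityʳ (e (suc x)) | +-identityʳ (e (suc x)) | +-identityʳ x = ≤-refl
    go x@(suc x′) y@(suc y′) (acc rs) = begin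
      e x + e y + x ⊓ y
        ≡⟨ cong₂ (λ u v → u + v + x ⊓ y) (edgesBelow-halves x) (edgesBelow-halves y) ⟩
      e x₀ + e x₁ + x₀ + (e y₀ + e y₁ + y₀) + x ⊓ y
        ≡⟨ solve 7 (λ a b c d x₀ y₀ m → a :+ b :+ x₀ :+ (c :+ d :+ y₀) :+ m
                                         := a :+ d :+ (b :+ c) :+ (m :+ x₀ :+ y₀))
                 refl (e x₀) (e x₁) (e y₀) (e y₁) x₀ y₀ (x ⊓ y) ⟩
      e x₀ + e y₁ + (e x₁ + e y₀) + (x ⊓ y + x₀ + y₀)
        ≤⟨ +-monoʳ-≤ (e x₀ + e y₁ + (e x₁ + e y₀)) (⊓-halves x y) ⟩
      e x₀ + e y₁ + (e x₁ + e y₀) + (x₀ ⊓ y₁ + x₁ ⊓ y₀ + ⌊ x + y /2⌋)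
        ≡⟨ solve 7 (λ a b c d p q r → a :+ d :+ (b :+ c) :+ (p :+ q :+ r)
                                       := a :+ d :+ p :+ (b :+ c :+ q) :+ r)
                 refl (e x₀) (e x₁) (e y₀) (e y₁) (x₀ ⊓ y₁) (x₁ ⊓ y₀) ⌊ x + y /2⌋ ⟩
      e x₀ + e y₁ + x₀ ⊓ y₁ + (e x₁ + e y₀ + x₁ ⊓ y₀) + ⌊ x + y /2⌋
        ≤⟨ +-monoˡ-≤ ⌊ x + y /2⌋ (+-mono-≤
             (go x₀ y₁ (rs (+-mono-<-≤ (⌊n/2⌋<n x′) (⌈n/2⌉≤n y))))
             (go x₁ y₀ (rs (+-mono-≤-< (⌈n/2⌉≤n x) (⌊n/2⌋<n y′))))) ⟩
      e (x₀ + y₁) + e (x₁ + y₀) + ⌊ x + y /2⌋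
        ≡⟨ edgesBelow-+ x y ⟨
      e (x + y) ∎
      where
      open ≤-Reasoning
      x₀ = ⌊ x /2⌋
      x₁ = ⌈ x /2⌉
      y₀ = ⌊ y /2⌋
      y₁ = ⌈ y /2⌉

  ⌊n+n+x/2⌋≡n+⌊x/2⌋ : ∀ n x → ⌊ n + n + x /2⌋ ≡ n + ⌊ x /2⌋
  ⌊n+n+x/2⌋≡n+⌊x/2⌋ zero    x = refl
  ⌊n+n+x/2⌋≡n+⌊x/2⌋ (suc n) x =
    trans (cong (λ z → ⌊ suc z + x /2⌋) (+-suc n n)) (cong suc (⌊n+n+x/2⌋≡n+⌊x/2⌋ n x))

  ⌈n+n+x/2⌉≡n+⌈x/2⌉ : ∀ n x → ⌈ n + n + x /2⌉ ≡ n + ⌈ x /2⌉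
  ⌈n+n+x/2⌉≡n+⌈x/2⌉ n x = trans (cong ⌊_/2⌋ (sym (+-suc (n + n) x))) (⌊n+n+x/2⌋≡n+⌊x/2⌋ n (suc x))

  2^[1+t]≡2^t+2^t : ∀ t → 2 ^ suc t ≡ 2 ^ t + 2 ^ t
  2^[1+t]≡2^t+2^t t = cong (2 ^ t +_) (+-identityʳ (2 ^ t))

  edgesBelow-2^t+ : ∀ t x → x ≤ 2 ^ t → edgesBelow (2 ^ t + x) ≡ edgesBelow (2 ^ t) + edgesBelow x + x
  edgesBelow-2^t+ zero 0 _ = refl
  edgesBelow-2^t+ zero 1 _ = refl
  edgesBelow-2^t+ zero (suc (suc _)) (s≤s ())
  edgesBelow-2^t+ (suc t) x x≤2P = begin
    e (2 ^ suc t + x)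
      ≡⟨ cong (λ z → e (z + x)) (2^[1+t]≡2^t+2^t t) ⟩
    e (P + P + x)
      ≡⟨ edgesBelow-halves (P + P + x) ⟩
    e ⌊ P + P + x /2⌋ + e ⌈ P + P + x /2⌉ + ⌊ P + P + x /2⌋
      ≡⟨ cong₂ (λ u v → e u + e v + u) (⌊n+n+x/2⌋≡n+⌊x/2⌋ P x) (⌈n+n+x/2⌉≡n+⌈x/2⌉ P x) ⟩
    e (P + x₀) + e (P + x₁) + (P + x₀)
      ≡⟨ cong₂ (λ u v → u + v + (P + x₀))
           (edgesBelow-2^t+ t x₀ (≤-trans (⌊n/2⌋≤⌈n/2⌉ x) x₁≤P)) (edgesBelow-2^t+ t x₁ x₁≤P) ⟩
    e P + e x₀ + x₀ + (e P + e x₁ + x₁) + (P + x₀)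
      ≡⟨ solve 6 (λ h a b P x₀ x₁ → h :+ a :+ x₀ :+ (h :+ b :+ x₁) :+ (P :+ x₀)
                                    := h :+ h :+ P :+ (a :+ b :+ x₀) :+ (x₀ :+ x₁))
               refl (e P) (e x₀) (e x₁) P x₀ x₁ ⟩
    e P + e P + P + (e x₀ + e x₁ + x₀) + (x₀ + x₁)
      ≡⟨ cong₂ (λ u v → u + v + (x₀ + x₁)) (edgesBelow-double P) (edgesBelow-halves x) ⟨
    e (P + P) + e x + (x₀ + x₁)
      ≡⟨ cong₂ (λ u v → e u + e x + v) (sym (2^[1+t]≡2^t+2^t t)) (⌊n/2⌋+⌈n/2⌉≡n x) ⟩
    e (2 ^ suc t) + e x + x ∎
    where
    open ≡-Reasoning
    e = edgesBelow
    P = 2 ^ t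
    x₀ = ⌊ x /2⌋
    x₁ = ⌈ x /2⌉
    x₁≤P : x₁ ≤ P
    x₁≤P = subst (x₁ ≤_) (sym (n≡⌈n+n/2⌉ P))
             (⌈n/2⌉-mono (subst (x ≤_) (2^[1+t]≡2^t+2^t t) x≤2P))

  edgesBelow-split : ∀ t k → k ≤ 2 ^ suc t →
    edgesBelow k ≡ edgesBelow (2 ^ t ⊓ k) + edgesBelow (k ∸ 2 ^ t) + (k ∸ 2 ^ t)
  edgesBelow-split t k k≤2P with ≤-total k (2 ^ t)
  ... | inj₁ k≤P rewrite m≥n⇒m⊓n≡n k≤P | m≤n⇒m∸n≡0 k≤P = sym (trans (+-identityʳ _) (+-identityʳ _))
  ... | inj₂ P≤k rewrite m≤n⇒m⊓n≡m P≤k = begin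
    edgesBelow k
      ≡⟨ cong edgesBelow (m+[n∸m]≡n P≤k) ⟨
    edgesBelow (2 ^ t + (k ∸ 2 ^ t))
      ≡⟨ edgesBelow-2^t+ t (k ∸ 2 ^ t) k∸P≤P ⟩
    edgesBelow (2 ^ t) + edgesBelow (k ∸ 2 ^ t) + (k ∸ 2 ^ t) ∎
    where
    open ≡-Reasoning
    k∸P≤P : k ∸ 2 ^ t ≤ 2 ^ t
    k∸P≤P = subst (k ∸ 2 ^ t ≤_) (m+n∸n≡m (2 ^ t) (2 ^ t))
              (∸-monoˡ-≤ (2 ^ t) (subst (k ≤_) (2^[1+t]≡2^t+2^t t) k≤2P))

  [2^t+c]+[2^t+c]≡2^[1+t]+[c+c] : ∀ t c → (2 ^ t + c) + (2 ^ t + c) ≡ 2 ^ suc t + (c + c)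
  [2^t+c]+[2^t+c]≡2^[1+t]+[c+c] t c = trans
    (solve 2 (λ K c → (K :+ c) :+ (K :+ c) := (K :+ K) :+ (c :+ c)) refl (2 ^ t) c)
    (cong (_+ (c + c)) (sym (2^[1+t]≡2^t+2^t t)))

  edgesBelow-gap-a≤c : ∀ t a b c → a ≤ c → c ≤ 2 ^ t → a + b ≡ (2 ^ t + c) + (2 ^ t + c) →
    a + (edgesBelow a + edgesBelow b + a) ≤ edgesBelow (a + b)
  edgesBelow-gap-a≤c t a b c a≤c c≤2^t a+b≡2k = begin
    a + (e a + e b + a)
      ≡⟨ cong (λ z → a + (e a + e z + a)) b≡L+y ⟩
    a + (e a + e (L + y) + a)
      ≡⟨ cong (λ z → a + (e a + z + a)) (edgesBelow-2^t+ (suc t) y y≤L) ⟩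
    a + (e a + (e L + e y + y) + a)
      ≡⟨ solve 5 (λ a y ea eL ey → a :+ (ea :+ (eL :+ ey :+ y) :+ a) := eL :+ (ea :+ ey :+ a) :+ (a :+ y))
               refl a y (e a) (e L) (e y) ⟩
    e L + (e a + e y + a) + (a + y)
      ≤⟨ +-monoˡ-≤ (a + y) (+-monoʳ-≤ (e L) (subst (λ m → e a + e y + m ≤ e (a + y))
           (m≤n⇒m⊓n≡m a≤y) (edgesBelow-superadditive a y))) ⟩
    e L + e (a + y) + (a + y)
      ≡⟨ cong (λ z → e L + e z + z) a+y≡cc ⟩
    e L + e (c + c) + (c + c)
      ≡⟨ edgesBelow-2^t+ (suc t) (c + c) cc≤L ⟨
    e (L + (c + c))
      ≡⟨ cong e a+b≡L+cc ⟨
    e (a + b) ∎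
    where
    open ≤-Reasoning
    e = edgesBelow
    L = 2 ^ suc t
    y = c + c ∸ a
    a+b≡L+cc : a + b ≡ L + (c + c)
    a+b≡L+cc = trans a+b≡2k ([2^t+c]+[2^t+c]≡2^[1+t]+[c+c] t c)
    a+y≡cc : a + y ≡ c + c
    a+y≡cc = m+[n∸m]≡n (≤-trans a≤c (m≤m+n c c))
    a≤y : a ≤ y
    a≤y = ≤-trans a≤c (subst (_≤ y) (m+n∸n≡m c c) (∸-monoʳ-≤ (c + c) a≤c))
    cc≤L : c + c ≤ L
    cc≤L = subst (c + c ≤_) (sym (2^[1+t]≡2^t+2^t t)) (+-mono-≤ c≤2^t c≤2^t)
    y≤L : y ≤ L
    y≤L = ≤-trans (m∸n≤m (c + c) a) cc≤L
    b≡L+y : b ≡ L + y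
    b≡L+y = +-cancelˡ-≡ a b (L + y) (begin-equality
      a + b        ≡⟨ a+b≡L+cc ⟩
      L + (c + c)  ≡⟨ cong (L +_) a+y≡cc ⟨
      L + (a + y)  ≡⟨ solve 3 (λ a L y → L :+ (a :+ y) := a :+ (L :+ y)) refl a L y ⟩
      a + (L + y)  ∎)

  gap-3c≤a-bounds : ∀ {K a c y} → 3 * c ≤ a → 2 * a ≤ K + c → a + y ≡ K + (c + c) →
    c + c ≤ K × y ≤ K × 3 * (c + c) + a ≤ 3 * (a ⊓ y)
  gap-3c≤a-bounds {K} {a} {c} {y} 3c≤a 2a≤K+c a+y≡K+cc = cc≤K , y≤K , 6c+a≤3[a⊓y]
    where
    open ≤-Reasoning
    6c≤2a : 3 * (c + c) ≤ 2 * a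
    6c≤2a = subst (_≤ 2 * a) (solve 1 (λ c → con 2 :* (con 3 :* c) := con 3 :* (c :+ c)) refl c)
              (*-monoʳ-≤ 2 3c≤a)
    cc≤K : c + c ≤ K
    cc≤K = +-cancelʳ-≤ c (c + c) K (begin
      c + c + c        ≤⟨ m≤m+n (c + c + c) (c + c + c) ⟩
      c + c + c + (c + c + c) ≡⟨ solve 1 (λ c → c :+ c :+ c :+ (c :+ c :+ c) := con 3 :* (c :+ c)) refl c ⟩
      3 * (c + c)      ≤⟨ 6c≤2a ⟩
      2 * a            ≤⟨ 2a≤K+c ⟩
      K + c            ∎)
    cc≤a : c + c ≤ a
    cc≤a = ≤-trans (m≤m+n (c + c) c) (subst (_≤ a) (solve 1 (λ c → con 3 :* c := c :+ c :+ c) refl c) 3c≤a)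
    y≤K : y ≤ K
    y≤K = +-cancelˡ-≤ (c + c) y K (begin
      c + c + y  ≤⟨ +-monoˡ-≤ y cc≤a ⟩
      a + y      ≡⟨ a+y≡K+cc ⟩
      K + (c + c) ≡⟨ +-comm K (c + c) ⟩
      c + c + K  ∎)
    5a≤3K : 5 * a ≤ 3 * K
    5a≤3K = +-cancelʳ-≤ a (5 * a) (3 * K) (begin
      5 * a + a        ≡⟨ solve 1 (λ a → con 5 :* a :+ a := con 3 :* (con 2 :* a)) refl a ⟩
      3 * (2 * a)      ≤⟨ *-monoʳ-≤ 3 2a≤K+c ⟩
      3 * (K + c)      ≡⟨ *-distribˡ-+ 3 K c ⟩
      3 * K + 3 * c    ≤⟨ +-monoʳ-≤ (3 * K) 3c≤a ⟩
      3 * K + a        ∎)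
    6c+a≤3a : 3 * (c + c) + a ≤ 3 * a
    6c+a≤3a = ≤-trans (+-monoˡ-≤ a 6c≤2a) (≤-reflexive (solve 1 (λ a → con 2 :* a :+ a := con 3 :* a) refl a))
    6c+a≤3y : 3 * (c + c) + a ≤ 3 * y
    6c+a≤3y = +-cancelʳ-≤ (3 * a) (3 * (c + c) + a) (3 * y) (begin
      3 * (c + c) + a + 3 * a ≡⟨ solve 2 (λ c a → con 3 :* (c :+ c) :+ a :+ con 3 :* a
                                                   := con 3 :* (c :+ c) :+ con 4 :* a) refl c a ⟩
      3 * (c + c) + 4 * a     ≤⟨ +-monoʳ-≤ (3 * (c + c)) (≤-trans (*-monoˡ-≤ a (n≤1+n 4)) 5a≤3K) ⟩
      3 * (c + c) + 3 * K     ≡⟨ solve 2 (λ c K → con 3 :* (c :+ c) :+ con 3 :* K := con 3 :* (K :+ (c :+ c)))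
                                        refl c K ⟩
      3 * (K + (c + c))       ≡⟨ cong (3 *_) a+y≡K+cc ⟨
      3 * (a + y)             ≡⟨ solve 2 (λ a y → con 3 :* (a :+ y) := con 3 :* y :+ con 3 :* a) refl a y ⟩
      3 * y + 3 * a           ∎)
    6c+a≤3[a⊓y] : 3 * (c + c) + a ≤ 3 * (a ⊓ y)
    6c+a≤3[a⊓y] = subst (3 * (c + c) + a ≤_) (sym (*-distribˡ-⊓ 3 a y)) (⊓-glb 6c+a≤3a 6c+a≤3y)

  edgesBelow-gap-3c≤a : ∀ t a b c → 3 * c ≤ a → 2 * a ≤ 2 ^ t + c → a + b ≡ (2 ^ t + c) + (2 ^ t + c) →
    a + 3 * (edgesBelow a + edgesBelow b + a) ≤ 3 * edgesBelow (a + b)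
  edgesBelow-gap-3c≤a t a b c 3c≤a 2a≤K+c a+b≡2k = +-cancelʳ-≤ (3 * μ) _ _ (begin
    a + 3 * (e a + e b + a) + 3 * μ
      ≡⟨ cong (λ z → a + 3 * (e a + z + a) + 3 * μ) (trans (cong e b≡K+y) (edgesBelow-2^t+ t y y≤K)) ⟩
    a + 3 * (e a + (e K + e y + y) + a) + 3 * μ
      ≡⟨ solve 6 (λ a y μ ea eK ey → a :+ con 3 :* (ea :+ (eK :+ ey :+ y) :+ a) :+ con 3 :* μ
                                       := con 3 :* (ea :+ ey :+ μ) :+ con 3 :* eK :+ (con 3 :* (a :+ y) :+ a))
               refl a y μ (e a) (e K) (e y) ⟩
    3 * (e a + e y + μ) + 3 * e K + (3 * (a + y) + a)
      ≤⟨ +-monoˡ-≤ (3 * (a + y) + a) (+-monoˡ-≤ (3 * e K) (*-monoʳ-≤ 3 (edgesBelow-superadditive a y))) ⟩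
    3 * e (a + y) + 3 * e K + (3 * (a + y) + a)
      ≡⟨ cong (λ z → 3 * e z + 3 * e K + (3 * z + a)) a+y≡K+cc ⟩
    3 * e (K + cc) + 3 * e K + (3 * (K + cc) + a)
      ≡⟨ cong (λ z → 3 * z + 3 * e K + (3 * (K + cc) + a)) (edgesBelow-2^t+ t cc cc≤K) ⟩
    3 * (e K + e cc + cc) + 3 * e K + (3 * (K + cc) + a)
      ≡⟨ solve 5 (λ eK ecc cc K a → con 3 :* (eK :+ ecc :+ cc) :+ con 3 :* eK :+ (con 3 :* (K :+ cc) :+ a)
                                     := con 3 :* (eK :+ eK :+ K :+ ecc :+ cc) :+ (con 3 :* cc :+ a))
               refl (e K) (e cc) cc K a ⟩
    3 * (e K + e K + K + e cc + cc) + (3 * cc + a)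
      ≤⟨ +-monoʳ-≤ (3 * (e K + e K + K + e cc + cc)) 6c+a≤3μ ⟩
    3 * (e K + e K + K + e cc + cc) + 3 * μ
      ≡⟨ cong (λ z → 3 * (z + e cc + cc) + 3 * μ) (edgesBelow-double K) ⟨
    3 * (e (K + K) + e cc + cc) + 3 * μ
      ≡⟨ cong (λ z → 3 * (e z + e cc + cc) + 3 * μ) (2^[1+t]≡2^t+2^t t) ⟨
    3 * (e L + e cc + cc) + 3 * μ
      ≡⟨ cong (λ z → 3 * z + 3 * μ) (edgesBelow-2^t+ (suc t) cc cc≤L) ⟨
    3 * e (L + cc) + 3 * μ
      ≡⟨ cong (λ z → 3 * e z + 3 * μ) a+b≡L+cc ⟨
    3 * e (a + b) + 3 * μ ∎)
    where
    open ≤-Reasoning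
    e = edgesBelow
    K = 2 ^ t
    L = 2 ^ suc t
    cc = c + c
    a+b≡L+cc : a + b ≡ L + cc
    a+b≡L+cc = trans a+b≡2k ([2^t+c]+[2^t+c]≡2^[1+t]+[c+c] t c)
    y = K + cc ∸ a
    μ = a ⊓ y
    a≤K+cc : a ≤ K + cc
    a≤K+cc = ≤-trans (m≤m+n a (a + 0)) (≤-trans 2a≤K+c (+-monoʳ-≤ K (m≤m+n c c)))
    a+y≡K+cc : a + y ≡ K + cc
    a+y≡K+cc = m+[n∸m]≡n a≤K+cc
    bounds = gap-3c≤a-bounds 3c≤a 2a≤K+c a+y≡K+cc
    cc≤K = proj₁ bounds
    y≤K = proj₁ (proj₂ bounds)
    6c+a≤3μ = proj₂ (proj₂ bounds)
    cc≤L : cc ≤ L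
    cc≤L = ≤-trans cc≤K (m≤m+n K (K + 0))
    b≡K+y : b ≡ K + y
    b≡K+y = +-cancelˡ-≡ a b (K + y) (begin-equality
      a + b         ≡⟨ a+b≡L+cc ⟩
      L + cc        ≡⟨ cong (_+ cc) (2^[1+t]≡2^t+2^t t) ⟩
      K + K + cc    ≡⟨ +-assoc K K cc ⟩
      K + (K + cc)  ≡⟨ cong (K +_) a+y≡K+cc ⟨
      K + (a + y)   ≡⟨ solve 3 (λ a K y → K :+ (a :+ y) := a :+ (K :+ y)) refl a K y ⟩
      a + (K + y)   ∎)

module Boundaries where

  open import Data.Bool.Base using (Bool; true; false; not; _xor_; T)
  open import Data.Bool.Properties using (T?; xor-comm)
  open import Data.List.Base using (List; []; _∷_; _++_; map; filter; length)
  open import Data.List.Properties using (filter-++; length-++; filter-≐)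
  open import Data.Nat.Base
  open import Data.Nat.Properties
  open import Data.Nat.Solver using (module +-*-Solver)
  open import Data.Empty using (⊥-elim)
  open import Data.Product.Base using (_,_)
  open import Data.Vec.Base using (Vec; []; _∷_; updateAt)
  open import Data.Fin.Base using (Fin)
  open import Algebra.Properties.CommutativeMonoid.Sum +-0-commutativeMonoid
    using (sum; sum-cong-≗; ∑-distrib-+)
  open import Algebra.Properties.CommutativeSemigroup +-commutativeSemigroup using (interchange)
  open import Relation.Binary.PropositionalEquality
  open import Defs
  open EdgesBelow
  open +-*-Solver using (solve; _:+_; _:*_; _:=_; con)

  length-filter-map : ∀ {A B : Set} (P : B → Bool) (f : A → B) (xs : List A) →
    length (filter (λ y → T? (P y)) (map f xs)) ≡ length (filter (λ x → T? (P (f x))) xs)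
  length-filter-map P f [] = refl
  length-filter-map P f (x ∷ xs) with P (f x)
  ... | true  = cong suc (length-filter-map P f xs)
  ... | false = length-filter-map P f xs

  count-suc : ∀ {N} (P : Family (suc N)) →
    count P ≡ count (λ S → P (true ∷ S)) + count (λ S → P (false ∷ S))
  count-suc {N} P = begin
    length (filter P? (map (true ∷_) L ++ map (false ∷_) L))
      ≡⟨ cong length (filter-++ P? (map (true ∷_) L) (map (false ∷_) L)) ⟩
    length (filter P? (map (true ∷_) L) ++ filter P? (map (false ∷_) L))
      ≡⟨ length-++ (filter P? (map (true ∷_) L)) ⟩
    length (filter P? (map (true ∷_) L)) + length (filter P? (map (false ∷_) L))
      ≡⟨ cong₂ _+_ (length-filter-map P (true ∷_) L) (length-filter-map P (false ∷_) L) ⟩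
    count (λ S → P (true ∷ S)) + count (λ S → P (false ∷ S)) ∎
    where
    open ≡-Reasoning
    L = allSubsets N
    P? = λ (S : Vec Bool (suc N)) → T? (P S)

  count-cong : ∀ {N} {P Q : Family N} → (∀ S → P S ≡ Q S) → count P ≡ count Q
  count-cong {N} {P} {Q} P≗Q = cong length (filter-≐ (λ S → T? (P S)) (λ S → T? (Q S))
    ((λ {S} → subst T (P≗Q S)) , (λ {S} → subst T (sym (P≗Q S)))) (allSubsets N))

  count-false : ∀ N → count {N} (λ _ → false) ≡ 0
  count-false zero    = refl
  count-false (suc N) = trans (count-suc {N} (λ _ → false)) (cong₂ _+_ (count-false N) (count-false N))

  count-true : ∀ N → count {N} (λ _ → true) ≡ 2 ^ N
  count-true zero    = refl
  count-true (suc N) = trans (count-suc {N} (λ _ → true))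
    (cong₂ _+_ (count-true N) (trans (count-true N) (sym (+-identityʳ (2 ^ N)))))

  count-xor-⊆ : ∀ {N} {P Q : Family N} → (∀ S → T (Q S) → T (P S)) →
    count (λ S → P S xor Q S) + count Q ≡ count P
  count-xor-⊆ {zero} {P} {Q} Q⊆P with P [] | Q [] | Q⊆P []
  ... | true  | true  | _ = refl
  ... | true  | false | _ = refl
  ... | false | false | _ = refl
  ... | false | true  | Q⊆P[] = ⊥-elim (Q⊆P[] _)
  count-xor-⊆ {suc N} {P} {Q} Q⊆P = begin
    count (λ S → P S xor Q S) + count Q
      ≡⟨ cong₂ _+_ (count-suc (λ S → P S xor Q S)) (count-suc Q) ⟩
    X₁ + X₀ + (Q₁ + Q₀)
      ≡⟨ interchange X₁ X₀ Q₁ Q₀ ⟩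
    X₁ + Q₁ + (X₀ + Q₀)
      ≡⟨ cong₂ _+_ (count-xor-⊆ (λ S → Q⊆P (true ∷ S))) (count-xor-⊆ (λ S → Q⊆P (false ∷ S))) ⟩
    count (λ S → P (true ∷ S)) + count (λ S → P (false ∷ S))
      ≡⟨ count-suc P ⟨
    count P ∎
    where
    open ≡-Reasoning
    X₁ = count (λ S → P (true ∷ S) xor Q (true ∷ S))
    X₀ = count (λ S → P (false ∷ S) xor Q (false ∷ S))
    Q₁ = count (λ S → Q (true ∷ S))
    Q₀ = count (λ S → Q (false ∷ S))

  rank : ∀ {N} → Vec Bool N → ℕ
  rank S = count (λ T → lexGt T S)

  rank-true : ∀ {N} (S : Vec Bool N) → rank (true ∷ S) ≡ rank S
  rank-true {N} S = trans (count-suc (λ T → lexGt T (true ∷ S)))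
    (trans (cong (rank S +_) (count-false N)) (+-identityʳ (rank S)))

  rank-false : ∀ {N} (S : Vec Bool N) → rank (false ∷ S) ≡ 2 ^ N + rank S
  rank-false {N} S = trans (count-suc (λ T → lexGt T (false ∷ S))) (cong (_+ rank S) (count-true N))

  rank<2^N : ∀ {N} (S : Vec Bool N) → rank S < 2 ^ N
  rank<2^N [] = s≤s z≤n
  rank<2^N {suc N} (true ∷ S) rewrite rank-true S = ≤-trans (rank<2^N S) (m≤m+n (2 ^ N) _)
  rank<2^N {suc N} (false ∷ S) rewrite rank-false S =
    +-monoʳ-< (2 ^ N) (≤-trans (rank<2^N S) (≤-reflexive (sym (+-identityʳ (2 ^ N)))))

  <ᵇ-⊓ : ∀ r n k → r < n → (r <ᵇ n ⊓ k) ≡ (r <ᵇ k)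
  <ᵇ-⊓ zero    (suc n) zero    _ = refl
  <ᵇ-⊓ zero    (suc n) (suc k) _ = refl
  <ᵇ-⊓ (suc r) (suc n) zero    _ = refl
  <ᵇ-⊓ (suc r) (suc n) (suc k) (s≤s r<n) = <ᵇ-⊓ r n k r<n

  +-<ᵇ : ∀ n r k → (n + r <ᵇ k) ≡ (r <ᵇ k ∸ n)
  +-<ᵇ zero    r k       = refl
  +-<ᵇ (suc n) r zero    = refl
  +-<ᵇ (suc n) r (suc k) = +-<ᵇ n r k

  lexSeg-suc : ∀ m k S → lexSeg (suc m) k S ≡ fracLex m (k ∸ 2 ^ m) (2 ^ m ⊓ k) S
  lexSeg-suc m k (true ∷ S)  = trans (cong (_<ᵇ k) (rank-true S)) (sym (<ᵇ-⊓ (rank S) (2 ^ m) k (rank<2^N S)))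
  lexSeg-suc m k (false ∷ S) = trans (cong (_<ᵇ k) (rank-false S)) (+-<ᵇ (2 ^ m) (rank S) k)

  lexSeg-mono : ∀ {m a b} → a ≤ b → ∀ S → T (lexSeg m a S) → T (lexSeg m b S)
  lexSeg-mono {a = a} {b} a≤b S r<a = <⇒<ᵇ (<-≤-trans (<ᵇ⇒< (rank S) a r<a) a≤b)

  ∸≤⊓ : ∀ {n k} → k ≤ n + n → k ∸ n ≤ n ⊓ k
  ∸≤⊓ {n} {k} k≤2n = ⊓-glb (subst (k ∸ n ≤_) (m+n∸n≡m n n) (∸-monoˡ-≤ n k≤2n)) (m∸n≤m k n)

  count-lexSeg : ∀ m k → k ≤ 2 ^ m → count (lexSeg m k) ≡ k
  count-lexSeg zero 0 _ = refl
  count-lexSeg zero 1 _ = refl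
  count-lexSeg zero (suc (suc _)) (s≤s ())
  count-lexSeg (suc m) k k≤2P = begin
    count (lexSeg (suc m) k)
      ≡⟨ count-cong (lexSeg-suc m k) ⟩
    count (fracLex m (k ∸ P) (P ⊓ k))
      ≡⟨ count-suc (fracLex m (k ∸ P) (P ⊓ k)) ⟩
    count (lexSeg m (P ⊓ k)) + count (lexSeg m (k ∸ P))
      ≡⟨ cong₂ _+_ (count-lexSeg m (P ⊓ k) (m⊓n≤m P k))
                   (count-lexSeg m (k ∸ P)
                     (≤-trans (∸≤⊓ (subst (k ≤_) (2^[1+t]≡2^t+2^t m) k≤2P)) (m⊓n≤m P k))) ⟩
    P ⊓ k + (k ∸ P)
      ≡⟨ m⊓n+n∸m≡n P k ⟩
    k ∎
    where
    open ≡-Reasoning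
    P = 2 ^ m

  boundary : ∀ {N} → Family N → ℕ
  boundary H = sum (λ i → count (λ A → H A xor H (updateAt A i not)))

  boundary-cong : ∀ {N} {H H′ : Family N} → (∀ S → H S ≡ H′ S) → boundary H ≡ boundary H′
  boundary-cong {N} H≗H′ =
    sum-cong-≗ {N} (λ i → count-cong (λ A → cong₂ _xor_ (H≗H′ A) (H≗H′ (updateAt A i not))))

  boundary-suc : ∀ {N} (H : Family (suc N)) →
    boundary H ≡ 2 * count (λ S → H (true ∷ S) xor H (false ∷ S))
                 + boundary (λ S → H (true ∷ S)) + boundary (λ S → H (false ∷ S))
  boundary-suc {N} H = begin
    boundary H
      ≡⟨ cong₂ _+_ (trans (count-suc (λ A → H A xor H (updateAt A Fin.zero not)))
                          (cong (X +_) (count-cong (λ S → xor-comm (H (false ∷ S)) (H (true ∷ S))))))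
                   (trans (sum-cong-≗ {N} (λ i → count-suc (λ A → H A xor H (updateAt A (Fin.suc i) not))))
                          (∑-distrib-+ (λ i → count (λ S → H₁ S xor H₁ (updateAt S i not)))
                                       (λ i → count (λ S → H₀ S xor H₀ (updateAt S i not))))) ⟩
    X + X + (boundary H₁ + boundary H₀)
      ≡⟨ cong (λ z → X + z + (boundary H₁ + boundary H₀)) (+-identityʳ X) ⟨
    2 * X + (boundary H₁ + boundary H₀)
      ≡⟨ +-assoc (2 * X) _ _ ⟨
    2 * X + boundary H₁ + boundary H₀ ∎
    where
    open ≡-Reasoning
    X = count (λ S → H (true ∷ S) xor H (false ∷ S))
    H₁ H₀ : Family N
    H₁ S = H (true ∷ S)
    H₀ S = H (false ∷ S)

  boundary-fracLex : ∀ m a b → a ≤ b → b ≤ 2 ^ m →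
    boundary (fracLex m a b) + 2 * a ≡ 2 * b + boundary (lexSeg m b) + boundary (lexSeg m a)
  boundary-fracLex m a b a≤b b≤2^m = begin
    boundary (fracLex m a b) + 2 * a
      ≡⟨ cong (_+ 2 * a) (boundary-suc (fracLex m a b)) ⟩
    2 * X + Bb + Ba + 2 * a
      ≡⟨ solve 4 (λ X Bb Ba a → con 2 :* X :+ Bb :+ Ba :+ con 2 :* a := con 2 :* (X :+ a) :+ Bb :+ Ba)
               refl X Bb Ba a ⟩
    2 * (X + a) + Bb + Ba
      ≡⟨ cong (λ z → 2 * z + Bb + Ba) X+a≡b ⟩
    2 * b + Bb + Ba ∎
    where
    open ≡-Reasoning
    X = count (λ S → lexSeg m b S xor lexSeg m a S)
    Bb = boundary (lexSeg m b)
    Ba = boundary (lexSeg m a)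
    X+a≡b : X + a ≡ b
    X+a≡b = begin
      X + a                   ≡⟨ cong (X +_) (count-lexSeg m a (≤-trans a≤b b≤2^m)) ⟨
      X + count (lexSeg m a)  ≡⟨ count-xor-⊆ (lexSeg-mono {m} a≤b) ⟩
      count (lexSeg m b)      ≡⟨ count-lexSeg m b b≤2^m ⟩
      b                       ∎

  boundary-lexSeg : ∀ m k → k ≤ 2 ^ m → boundary (lexSeg m k) + 4 * edgesBelow k ≡ 2 * m * k
  boundary-lexSeg zero 0 _ = refl
  boundary-lexSeg zero 1 _ = refl
  boundary-lexSeg zero (suc (suc _)) (s≤s ())
  boundary-lexSeg (suc m) k k≤2P = +-cancelʳ-≡ (2 * a) _ _ (begin
    boundary (lexSeg (suc m) k) + 4 * e k + 2 * a
      ≡⟨ cong₂ (λ u v → u + 4 * v + 2 * a) (boundary-cong (lexSeg-suc m k)) (edgesBelow-split m k k≤2P) ⟩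
    F + 4 * (e b + e a + a) + 2 * a
      ≡⟨ solve 4 (λ F eb ea a → F :+ con 4 :* (eb :+ ea :+ a) :+ con 2 :* a
                                  := F :+ con 2 :* a :+ con 4 :* (eb :+ ea :+ a)) refl F (e b) (e a) a ⟩
    F + 2 * a + 4 * (e b + e a + a)
      ≡⟨ cong (_+ 4 * (e b + e a + a)) (boundary-fracLex m a b a≤b b≤P) ⟩
    2 * b + Bb + Ba + 4 * (e b + e a + a)
      ≡⟨ solve 6 (λ b a Bb Ba eb ea → con 2 :* b :+ Bb :+ Ba :+ con 4 :* (eb :+ ea :+ a)
                                     := (Bb :+ con 4 :* eb) :+ (Ba :+ con 4 :* ea) :+ con 2 :* b :+ con 4 :* a)
               refl b a Bb Ba (e b) (e a) ⟩
    (Bb + 4 * e b) + (Ba + 4 * e a) + 2 * b + 4 * a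
      ≡⟨ cong₂ (λ u v → u + v + 2 * b + 4 * a) (boundary-lexSeg m b b≤P) (boundary-lexSeg m a a≤P) ⟩
    2 * m * b + 2 * m * a + 2 * b + 4 * a
      ≡⟨ solve 3 (λ m b a → con 2 :* m :* b :+ con 2 :* m :* a :+ con 2 :* b :+ con 4 :* a
                            := con 2 :* (con 1 :+ m) :* (b :+ a) :+ con 2 :* a) refl m b a ⟩
    2 * suc m * (b + a) + 2 * a
      ≡⟨ cong (λ z → 2 * suc m * z + 2 * a) (m⊓n+n∸m≡n P k) ⟩
    2 * suc m * k + 2 * a ∎)
    where
    open ≡-Reasoning
    e = edgesBelow
    P = 2 ^ m
    a = k ∸ P
    b = P ⊓ k
    F = boundary (fracLex m a b)
    Bb = boundary (lexSeg m b)
    Ba = boundary (lexSeg m a)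
    b≤P : b ≤ P
    b≤P = m⊓n≤m P k
    a≤b : a ≤ b
    a≤b = ∸≤⊓ (subst (k ≤_) (2^[1+t]≡2^t+2^t m) k≤2P)
    a≤P : a ≤ P
    a≤P = ≤-trans a≤b b≤P

  boundary-fracLex-lexSeg : ∀ m a b k → a ≤ b → b ≤ 2 ^ m → a + b ≡ k + k →
    boundary (fracLex m a b) + 4 * (edgesBelow a + edgesBelow b + a)
      ≡ 2 * boundary (lexSeg m k) + 4 * edgesBelow (a + b)
  boundary-fracLex-lexSeg m a b k a≤b b≤2^m a+b≡k+k = +-cancelʳ-≡ (2 * a) _ _ (begin
    F + 4 * (e a + e b + a) + 2 * a
      ≡⟨ solve 4 (λ F ea eb a → F :+ con 4 :* (ea :+ eb :+ a) :+ con 2 :* a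
                                := F :+ con 2 :* a :+ con 4 :* (ea :+ eb :+ a)) refl F (e a) (e b) a ⟩
    F + 2 * a + 4 * (e a + e b + a)
      ≡⟨ cong (_+ 4 * (e a + e b + a)) (boundary-fracLex m a b a≤b b≤2^m) ⟩
    2 * b + Bb + Ba + 4 * (e a + e b + a)
      ≡⟨ solve 6 (λ a b Ba Bb ea eb → con 2 :* b :+ Bb :+ Ba :+ con 4 :* (ea :+ eb :+ a)
                                     := (Ba :+ con 4 :* ea) :+ (Bb :+ con 4 :* eb) :+ con 2 :* (a :+ b) :+ con 2 :* a)
               refl a b Ba Bb (e a) (e b) ⟩
    (Ba + 4 * e a) + (Bb + 4 * e b) + 2 * (a + b) + 2 * a
      ≡⟨ cong₂ (λ u v → u + v + 2 * (a + b) + 2 * a)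
               (boundary-lexSeg m a (≤-trans a≤b b≤2^m)) (boundary-lexSeg m b b≤2^m) ⟩
    2 * m * a + 2 * m * b + 2 * (a + b) + 2 * a
      ≡⟨ cong (_+ 2 * a) (solve 3 (λ m a b → con 2 :* m :* a :+ con 2 :* m :* b :+ con 2 :* (a :+ b)
                                              := con 2 :* m :* (a :+ b) :+ con 2 :* (a :+ b)) refl m a b) ⟩
    2 * m * (a + b) + 2 * (a + b) + 2 * a
      ≡⟨ cong (λ z → 2 * m * z + 2 * z + 2 * a) a+b≡k+k ⟩
    2 * m * (k + k) + 2 * (k + k) + 2 * a
      ≡⟨ solve 3 (λ m k ek → con 2 :* m :* (k :+ k) :+ con 2 :* (k :+ k) :+ ek
                             := con 2 :* (con 2 :* m :* k) :+ con 4 :* k :+ ek) refl m k (2 * a) ⟩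
    2 * (2 * m * k) + 4 * k + 2 * a
      ≡⟨ cong (λ z → 2 * z + 4 * k + 2 * a) (boundary-lexSeg m k k≤2^m) ⟨
    2 * (Bk + 4 * e k) + 4 * k + 2 * a
      ≡⟨ cong (_+ 2 * a) (solve 3 (λ Bk ek k → con 2 :* (Bk :+ con 4 :* ek) :+ con 4 :* k
                                               := con 2 :* Bk :+ con 4 :* (ek :+ ek :+ k)) refl Bk (e k) k) ⟩
    2 * Bk + 4 * (e k + e k + k) + 2 * a
      ≡⟨ cong (λ z → 2 * Bk + 4 * z + 2 * a) (trans (sym (edgesBelow-double k)) (cong e (sym a+b≡k+k))) ⟩
    2 * Bk + 4 * e (a + b) + 2 * a ∎)
    where
    open ≡-Reasoning
    e = edgesBelow
    F = boundary (fracLex m a b)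
    Bb = boundary (lexSeg m b)
    Ba = boundary (lexSeg m a)
    Bk = boundary (lexSeg m k)
    k≤2^m : k ≤ 2 ^ m
    k≤2^m = ≤-trans (≮⇒≥ (λ b<k → <⇒≱ (+-mono-< b<k b<k) (subst (_≤ b + b) a+b≡k+k (+-monoˡ-≤ b a≤b)))) b≤2^m

  boundary-fracLex-≥ : ∀ m a b k d → a ≤ b → b ≤ 2 ^ m → a + b ≡ k + k →
    a + d * (edgesBelow a + edgesBelow b + a) ≤ d * edgesBelow (a + b) →
    d * (2 * boundary (lexSeg m k)) + 2 * (2 * a) ≤ d * boundary (fracLex m a b)
  boundary-fracLex-≥ m a b k d a≤b b≤2^m a+b≡k+k gap = +-cancelʳ-≤ (4 * (d * E)) _ _ (begin
    d * (2 * Bk) + 2 * (2 * a) + 4 * (d * E)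
      ≡⟨ solve 4 (λ d Bk a E → d :* (con 2 :* Bk) :+ con 2 :* (con 2 :* a) :+ con 4 :* (d :* E)
                               := d :* (con 2 :* Bk) :+ con 4 :* (a :+ d :* E)) refl d Bk a E ⟩
    d * (2 * Bk) + 4 * (a + d * E)
      ≤⟨ +-monoʳ-≤ (d * (2 * Bk)) (*-monoʳ-≤ 4 gap) ⟩
    d * (2 * Bk) + 4 * (d * edgesBelow (a + b))
      ≡⟨ solve 3 (λ d Bk h → d :* (con 2 :* Bk) :+ con 4 :* (d :* h) := d :* (con 2 :* Bk :+ con 4 :* h))
               refl d Bk (edgesBelow (a + b)) ⟩
    d * (2 * Bk + 4 * edgesBelow (a + b))
      ≡⟨ cong (d *_) (boundary-fracLex-lexSeg m a b k a≤b b≤2^m a+b≡k+k) ⟨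
    d * (F + 4 * E)
      ≡⟨ solve 3 (λ d F E → d :* (F :+ con 4 :* E) := d :* F :+ con 4 :* (d :* E)) refl d F E ⟩
    d * F + 4 * (d * E) ∎)
    where
    open ≤-Reasoning
    E = edgesBelow a + edgesBelow b + a
    F = boundary (fracLex m a b)
    Bk = boundary (lexSeg m k)

module DyadicRationals where

  open import Data.Integer.Base as ℤ using (+_)
  import Data.Integer.Properties as ℤₚ
  open import Data.Nat.Base as ℕ using (ℕ; zero; suc; _^_; NonZero)
  import Data.Nat.Properties as ℕₚ
  open import Data.Nat.Solver using (module +-*-Solver)
  open import Data.Rational.Base using (ℚ; _/_; _+_; _*_; _≤_; _<_; ½; 0ℚ; toℚᵘ)
  import Data.Rational.Properties as ℚₚ
  open import Data.Rational.Unnormalised.Base as ℚᵘ using (ℚᵘ; mkℚᵘ; *≤*; _≃_) renaming (_≤_ to _≤ᵘ_)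
  import Data.Rational.Unnormalised.Properties as ℚᵘₚ
  open import Data.Empty using (⊥-elim)
  open import Relation.Binary.PropositionalEquality
  open import Defs using (dy)
  open +-*-Solver using (solve; _:+_; _:*_; _:=_; con)

  infixl 7 _/ₙ_
  _/ₙ_ : ℕ → (d : ℕ) → .{{NonZero d}} → ℚ
  x /ₙ d = + x / d

  private
    _/ᵘ_ : ℕ → (d : ℕ) → .{{NonZero d}} → ℚᵘ
    x /ᵘ d = + x ℚᵘ./ d

    toℚᵘ-/ₙ : ∀ x d .{{_ : NonZero d}} → toℚᵘ (x /ₙ d) ≃ x /ᵘ d
    toℚᵘ-/ₙ x (suc d) = ℚₚ.toℚᵘ-fromℚᵘ (mkℚᵘ (+ x) d)

    /ᵘ-≤ : ∀ x d y d′ .{{_ : NonZero d}} .{{_ : NonZero d′}} → x ℕ.* d′ ℕ.≤ y ℕ.* d → x /ᵘ d ≤ᵘ y /ᵘ d′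
    /ᵘ-≤ x (suc d) y (suc d′) h = *≤* (subst₂ ℤ._≤_ (ℤₚ.pos-* x (suc d′)) (ℤₚ.pos-* y (suc d)) (ℤ.+≤+ h))

    /ᵘ-≤⁻ : ∀ x d y d′ .{{_ : NonZero d}} .{{_ : NonZero d′}} → x /ᵘ d ≤ᵘ y /ᵘ d′ → x ℕ.* d′ ℕ.≤ y ℕ.* d
    /ᵘ-≤⁻ x (suc d) y (suc d′) (*≤* h) =
      ℤₚ.drop‿+≤+ (subst₂ ℤ._≤_ (sym (ℤₚ.pos-* x (suc d′))) (sym (ℤₚ.pos-* y (suc d))) h)

    ≃-numerator : ∀ {i j} d → i ≡ j → mkℚᵘ i d ≃ mkℚᵘ j d
    ≃-numerator d refl = ℚᵘₚ.≃-refl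

    /ᵘ-+ : ∀ x d y d′ .{{_ : NonZero d}} .{{_ : NonZero d′}} →
      x /ᵘ d ℚᵘ.+ y /ᵘ d′ ≃ _/ᵘ_ (x ℕ.* d′ ℕ.+ y ℕ.* d) (d ℕ.* d′) {{ℕₚ.m*n≢0 d d′}}
    /ᵘ-+ x (suc d) y (suc d′) = ≃-numerator _
      (trans (cong₂ ℤ._+_ (sym (ℤₚ.pos-* x (suc d′))) (sym (ℤₚ.pos-* y (suc d))))
             (sym (ℤₚ.pos-+ (x ℕ.* suc d′) (y ℕ.* suc d))))

    /ᵘ-* : ∀ x d y d′ .{{_ : NonZero d}} .{{_ : NonZero d′}} →
      x /ᵘ d ℚᵘ.* y /ᵘ d′ ≃ _/ᵘ_ (x ℕ.* y) (d ℕ.* d′) {{ℕₚ.m*n≢0 d d′}}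
    /ᵘ-* x (suc d) y (suc d′) = ≃-numerator _ (sym (ℤₚ.pos-* x y))

  /ₙ-≤ : ∀ x d y d′ .{{_ : NonZero d}} .{{_ : NonZero d′}} → x ℕ.* d′ ℕ.≤ y ℕ.* d → x /ₙ d ≤ y /ₙ d′
  /ₙ-≤ x d y d′ h = ℚₚ.toℚᵘ-cancel-≤
    (ℚᵘₚ.≤-respˡ-≃ (ℚᵘₚ.≃-sym (toℚᵘ-/ₙ x d)) (ℚᵘₚ.≤-respʳ-≃ (ℚᵘₚ.≃-sym (toℚᵘ-/ₙ y d′)) (/ᵘ-≤ x d y d′ h)))

  /ₙ-≤⁻ : ∀ x d y d′ .{{_ : NonZero d}} .{{_ : NonZero d′}} → x /ₙ d ≤ y /ₙ d′ → x ℕ.* d′ ℕ.≤ y ℕ.* d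
  /ₙ-≤⁻ x d y d′ h =
    /ᵘ-≤⁻ x d y d′ (ℚᵘₚ.≤-respˡ-≃ (toℚᵘ-/ₙ x d) (ℚᵘₚ.≤-respʳ-≃ (toℚᵘ-/ₙ y d′) (ℚₚ.toℚᵘ-mono-≤ h)))

  /ₙ-≡ : ∀ x d y d′ .{{_ : NonZero d}} .{{_ : NonZero d′}} → x ℕ.* d′ ≡ y ℕ.* d → x /ₙ d ≡ y /ₙ d′
  /ₙ-≡ x d y d′ e = ℚₚ.≤-antisym (/ₙ-≤ x d y d′ (ℕₚ.≤-reflexive e)) (/ₙ-≤ y d′ x d (ℕₚ.≤-reflexive (sym e)))

  /ₙ-≡⁻ : ∀ x d y d′ .{{_ : NonZero d}} .{{_ : NonZero d′}} → x /ₙ d ≡ y /ₙ d′ → x ℕ.* d′ ≡ y ℕ.* d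
  /ₙ-≡⁻ x d y d′ e =
    ℕₚ.≤-antisym (/ₙ-≤⁻ x d y d′ (ℚₚ.≤-reflexive e)) (/ₙ-≤⁻ y d′ x d (ℚₚ.≤-reflexive (sym e)))

  /ₙ-+ : ∀ x d y d′ .{{_ : NonZero d}} .{{_ : NonZero d′}} →
    x /ₙ d + y /ₙ d′ ≡ _/ₙ_ (x ℕ.* d′ ℕ.+ y ℕ.* d) (d ℕ.* d′) {{ℕₚ.m*n≢0 d d′}}
  /ₙ-+ x d y d′ = ℚₚ.toℚᵘ-injective (ℚᵘₚ.≃-trans (ℚₚ.toℚᵘ-homo-+ (x /ₙ d) (y /ₙ d′))
    (ℚᵘₚ.≃-trans (ℚᵘₚ.+-cong (toℚᵘ-/ₙ x d) (toℚᵘ-/ₙ y d′))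
      (ℚᵘₚ.≃-trans (/ᵘ-+ x d y d′) (ℚᵘₚ.≃-sym (toℚᵘ-/ₙ _ _ {{ℕₚ.m*n≢0 d d′}})))))

  /ₙ-* : ∀ x d y d′ .{{_ : NonZero d}} .{{_ : NonZero d′}} →
    (x /ₙ d) * (y /ₙ d′) ≡ _/ₙ_ (x ℕ.* y) (d ℕ.* d′) {{ℕₚ.m*n≢0 d d′}}
  /ₙ-* x d y d′ = ℚₚ.toℚᵘ-injective (ℚᵘₚ.≃-trans (ℚₚ.toℚᵘ-homo-* (x /ₙ d) (y /ₙ d′))
    (ℚᵘₚ.≃-trans (ℚᵘₚ.*-cong (toℚᵘ-/ₙ x d) (toℚᵘ-/ₙ y d′))
      (ℚᵘₚ.≃-trans (/ᵘ-* x d y d′) (ℚᵘₚ.≃-sym (toℚᵘ-/ₙ _ _ {{ℕₚ.m*n≢0 d d′}})))))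

  +-/ₙ : ∀ x y d .{{_ : NonZero d}} → x /ₙ d + y /ₙ d ≡ (x ℕ.+ y) /ₙ d
  +-/ₙ x y d = trans (/ₙ-+ x d y d) (/ₙ-≡ (x ℕ.* d ℕ.+ y ℕ.* d) (d ℕ.* d) (x ℕ.+ y) d {{ℕₚ.m*n≢0 d d}}
    (solve 3 (λ x y d → (x :* d :+ y :* d) :* d := (x :+ y) :* (d :* d)) refl x y d))

  module _ (m : ℕ) where
    private instance
      2^m≢0 : NonZero (2 ^ m)
      2^m≢0 = ℕₚ.m^n≢0 2 m

    dy-≤⁻ : ∀ x y → dy x m ≤ dy y m → x ℕ.≤ y
    dy-≤⁻ x y h = ℕₚ.*-cancelʳ-≤ x y (2 ^ m) (/ₙ-≤⁻ x (2 ^ m) y (2 ^ m) h)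

    dy-+ : ∀ x y → dy x m + dy y m ≡ dy (x ℕ.+ y) m
    dy-+ x y = +-/ₙ x y (2 ^ m)

    dy-injective : ∀ x y → dy x m ≡ dy y m → x ≡ y
    dy-injective x y h = ℕₚ.*-cancelʳ-≡ x y (2 ^ m) (/ₙ-≡⁻ x (2 ^ m) y (2 ^ m) h)

    dy-rescale : ∀ x t → dy x m ≡ dy (2 ^ t ℕ.* x) (t ℕ.+ m)
    dy-rescale x t = /ₙ-≡ x (2 ^ m) (2 ^ t ℕ.* x) (2 ^ (t ℕ.+ m)) {{2^m≢0}} {{ℕₚ.m^n≢0 2 (t ℕ.+ m)}} (begin
      x ℕ.* 2 ^ (t ℕ.+ m)        ≡⟨ cong (x ℕ.*_) (ℕₚ.^-distribˡ-+-* 2 t m) ⟩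
      x ℕ.* (2 ^ t ℕ.* 2 ^ m)    ≡⟨ solve 3 (λ x T M → x :* (T :* M) := T :* x :* M) refl x (2 ^ t) (2 ^ m) ⟩
      2 ^ t ℕ.* x ℕ.* 2 ^ m      ∎)
      where open ≡-Reasoning

    0<dy⇒0<x : ∀ x → 0ℚ < dy x m → 0 ℕ.< x
    0<dy⇒0<x zero 0<0 = ⊥-elim (ℚₚ.<-irrefl refl (subst (0ℚ <_) (/ₙ-≡ 0 (2 ^ m) 0 1 refl) 0<0))
    0<dy⇒0<x (suc x) _ = ℕ.s≤s ℕ.z≤n

  dy-* : ∀ x m y n → dy x m * dy y n ≡ dy (x ℕ.* y) (m ℕ.+ n)
  dy-* x m y n = trans (/ₙ-* x (2 ^ m) y (2 ^ n))
    (/ₙ-≡ (x ℕ.* y) (2 ^ m ℕ.* 2 ^ n) (x ℕ.* y) (2 ^ (m ℕ.+ n)) (cong (x ℕ.* y ℕ.*_) (ℕₚ.^-distribˡ-+-* 2 m n)))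
    where
    instance
      2^m≢0 : NonZero (2 ^ m)
      2^m≢0 = ℕₚ.m^n≢0 2 m
      2^n≢0 : NonZero (2 ^ n)
      2^n≢0 = ℕₚ.m^n≢0 2 n
      2^m2^n≢0 : NonZero (2 ^ m ℕ.* 2 ^ n)
      2^m2^n≢0 = ℕₚ.m*n≢0 (2 ^ m) (2 ^ n)
      2^[m+n]≢0 : NonZero (2 ^ (m ℕ.+ n))
      2^[m+n]≢0 = ℕₚ.m^n≢0 2 (m ℕ.+ n)

  ½*dy : ∀ x m → ½ * dy x m ≡ dy x (suc m)
  ½*dy x m = trans (dy-* 1 1 x m) (cong (λ z → dy z (suc m)) (ℕₚ.*-identityˡ x))

  dy-1-rescale : ∀ j m → j ℕ.≤ m → dy 1 j ≡ dy (2 ^ (m ℕ.∸ j)) m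
  dy-1-rescale j m j≤m =
    trans (dy-rescale j 1 (m ℕ.∸ j)) (cong₂ dy (ℕₚ.*-identityʳ (2 ^ (m ℕ.∸ j))) (ℕₚ.m∸n+n≡m j≤m))

  dy-midpoint : ∀ x y z m → (dy x m + dy y m) * ½ ≡ dy z m → x ℕ.+ y ≡ z ℕ.+ z
  dy-midpoint x y z m mean≡z = dy-injective (suc m) (x ℕ.+ y) (z ℕ.+ z) (begin
    dy (x ℕ.+ y) (suc m)  ≡⟨ ½*dy (x ℕ.+ y) m ⟨
    ½ * dy (x ℕ.+ y) m    ≡⟨ cong (½ *_) (dy-+ m x y) ⟨
    ½ * (dy x m + dy y m)  ≡⟨ ℚₚ.*-comm ½ (dy x m + dy y m) ⟩
    (dy x m + dy y m) * ½  ≡⟨ mean≡z ⟩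
    dy z m                 ≡⟨ dy-rescale m z 1 ⟩
    dy (2 ℕ.* z) (suc m)   ≡⟨ cong (λ u → dy (z ℕ.+ u) (suc m)) (ℕₚ.+-identityʳ z) ⟩
    dy (z ℕ.+ z) (suc m)  ∎)
    where open ≡-Reasoning

  dy≤2⁻ʲ⇒j≤m : ∀ x j m → 0ℚ < dy x m → dy x m ≤ dy 1 j → j ℕ.≤ m
  dy≤2⁻ʲ⇒j≤m x j m 0<x x≤2⁻ʲ = ℕₚ.≮⇒≥ λ m<j → ℕₚ.<⇒≱ (ℕₚ.^-monoʳ-< 2 (ℕ.s≤s (ℕ.s≤s ℕ.z≤n)) m<j) (begin
    2 ^ j              ≤⟨ ℕₚ.m≤n*m (2 ^ j) x {{ℕ.>-nonZero (0<dy⇒0<x m x 0<x)}} ⟩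
    x ℕ.* 2 ^ j        ≤⟨ /ₙ-≤⁻ x (2 ^ m) 1 (2 ^ j) {{ℕₚ.m^n≢0 2 m}} {{ℕₚ.m^n≢0 2 j}} x≤2⁻ʲ ⟩
    1 ℕ.* 2 ^ m        ≡⟨ ℕₚ.*-identityˡ (2 ^ m) ⟩
    2 ^ m              ∎)
    where open ℕₚ.≤-Reasoning

module Influence where

  open import Data.Fin.Base using (Fin; zero; suc)
  open import Data.Integer.Base using (+_)
  open import Data.Nat.Base as ℕ using (ℕ; _^_; NonZero)
  import Data.Nat.Properties as ℕₚ
  open import Data.Nat.Solver using (module +-*-Solver)
  open import Data.Rational.Base using (_/_; _+_; _*_; _≤_)
  open import Algebra.Properties.CommutativeMonoid.Sum ℕₚ.+-0-commutativeMonoid using (sum)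
  open import Relation.Binary.PropositionalEquality
  open import Defs
  open EdgesBelow using (edgesBelow)
  open Boundaries using (boundary; boundary-fracLex-≥)
  open DyadicRationals
  open +-*-Solver using (solve; _:+_; _:*_; _:=_; con)

  sumFin-/ₙ : ∀ N (g : Fin N → ℕ) d .{{_ : NonZero d}} → sumFin N (λ i → g i /ₙ d) ≡ sum g /ₙ d
  sumFin-/ₙ ℕ.zero    g d = /ₙ-≡ 0 1 0 d refl
  sumFin-/ₙ (ℕ.suc N) g d =
    trans (cong (λ q → g zero /ₙ d + q) (sumFin-/ₙ N (λ i → g (suc i)) d))
          (+-/ₙ (g zero) (sum (λ i → g (suc i))) d)

  I≡dy-boundary : ∀ {N} (H : Family N) → I H ≡ dy (boundary H) N
  I≡dy-boundary {N} H = sumFin-/ₙ N _ (2 ^ N) {{ℕₚ.m^n≢0 2 N}}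

  dy+n/d*dy≤dy : ∀ B a F m n d .{{_ : NonZero d}} →
    d ℕ.* (2 ℕ.* B) ℕ.+ n ℕ.* (2 ℕ.* a) ℕ.≤ d ℕ.* F →
    dy B m + (+ n / d) * dy a m ≤ dy F (ℕ.suc m)
  dy+n/d*dy≤dy B a F m n d h = subst (_≤ dy F (ℕ.suc m)) (sym lhs≡)
    (/ₙ-≤ (B ℕ.* (d ℕ.* P) ℕ.+ n ℕ.* a ℕ.* P) (P ℕ.* (d ℕ.* P)) F (2 ℕ.* P) (begin
    (B ℕ.* (d ℕ.* P) ℕ.+ n ℕ.* a ℕ.* P) ℕ.* (2 ℕ.* P)
      ≡⟨ solve 5 (λ B a n d P → (B :* (d :* P) :+ n :* a :* P) :* (con 2 :* P)
                                := P :* P :* (d :* (con 2 :* B) :+ n :* (con 2 :* a))) refl B a n d P ⟩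
    P ℕ.* P ℕ.* (d ℕ.* (2 ℕ.* B) ℕ.+ n ℕ.* (2 ℕ.* a))
      ≤⟨ ℕₚ.*-monoʳ-≤ (P ℕ.* P) h ⟩
    P ℕ.* P ℕ.* (d ℕ.* F)
      ≡⟨ solve 3 (λ F d P → P :* P :* (d :* F) := F :* (P :* (d :* P))) refl F d P ⟩
    F ℕ.* (P ℕ.* (d ℕ.* P)) ∎))
    where
    open ℕₚ.≤-Reasoning
    P = 2 ^ m
    instance
      P≢0 : NonZero P
      P≢0 = ℕₚ.m^n≢0 2 m
      dP≢0 : NonZero (d ℕ.* P)
      dP≢0 = ℕₚ.m*n≢0 d P
      PdP≢0 : NonZero (P ℕ.* (d ℕ.* P))
      PdP≢0 = ℕₚ.m*n≢0 P (d ℕ.* P)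
      2P≢0 : NonZero (2 ℕ.* P)
      2P≢0 = ℕₚ.m*n≢0 2 P
    lhs≡ : dy B m + (+ n / d) * dy a m ≡ (B ℕ.* (d ℕ.* P) ℕ.+ n ℕ.* a ℕ.* P) /ₙ (P ℕ.* (d ℕ.* P))
    lhs≡ = trans (cong (λ q → dy B m + q) (/ₙ-* n d a P)) (/ₙ-+ B P (n ℕ.* a) (d ℕ.* P))

  fracLex-influence-≥ : ∀ m a b k → a ℕ.≤ b → b ℕ.≤ 2 ^ m → a ℕ.+ b ≡ k ℕ.+ k → ∀ d .{{_ : NonZero d}} →
    a ℕ.+ d ℕ.* (edgesBelow a ℕ.+ edgesBelow b ℕ.+ a) ℕ.≤ d ℕ.* edgesBelow (a ℕ.+ b) →
    I (lexSeg m k) + (+ 2 / d) * dy a m ≤ I (fracLex m a b)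
  fracLex-influence-≥ m a b k a≤b b≤2^m a+b≡k+k d gap =
    subst₂ (λ u v → u + (+ 2 / d) * dy a m ≤ v)
      (sym (I≡dy-boundary (lexSeg m k))) (sym (I≡dy-boundary (fracLex m a b)))
      (dy+n/d*dy≤dy (boundary (lexSeg m k)) a (boundary (fracLex m a b)) m 2 d
        (boundary-fracLex-≥ m a b k d a≤b b≤2^m a+b≡k+k gap))

open import Defs
open import Data.Nat using (ℕ; _≤_)
open import Data.Integer using (+_)
open import Data.Rational using (ℚ; _/_; _+_; _*_; ½; 0ℚ; 1ℚ) renaming (_≤_ to _≤ℚ_; _<_ to _<ℚ_)
open import Data.Product using (_×_)
open import Relation.Binary.PropositionalEquality using (_≡_)

open import Data.Nat as ℕ using ()
import Data.Nat.Properties as ℕₚ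
open import Data.Product using (_,_)
open import Relation.Binary.PropositionalEquality using (sym; trans; cong; subst; subst₂)
open EdgesBelow using (edgesBelow-gap-a≤c; edgesBelow-gap-3c≤a)
open DyadicRationals
open Influence using (fracLex-influence-≥)

lemma5p1 : (j m k a b c : ℕ) → 2 ≤ j →
    0ℚ <ℚ dy c m → dy c m ≤ℚ dy 1 j →
    dy k m ≡ dy 1 j + dy c m →
    0ℚ ≤ℚ dy a m → dy a m ≤ℚ dy b m → dy b m ≤ℚ 1ℚ →
    (dy a m + dy b m) * ½ ≡ dy k m →
    (dy a m ≤ℚ dy c m →
    I (lexSeg m k) + (+ 2 / 1) * dy a m ≤ℚ I (fracLex m a b))
    × ((+ 3 / 1) * dy c m ≤ℚ dy a m → dy a m ≤ℚ ½ * dy k m →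
    I (lexSeg m k) + (+ 2 / 3) * dy a m ≤ℚ I (fracLex m a b))
lemma5p1 j m k a b c _ 0<c c≤2⁻ʲ k≡2⁻ʲ+c _ a≤b b≤1 mean≡k = case₁ , case₂
  where
  t = m ℕ.∸ j
  2⁻ʲ≡ : dy 1 j ≡ dy (2 ℕ.^ t) m
  2⁻ʲ≡ = dy-1-rescale j m (dy≤2⁻ʲ⇒j≤m c j m 0<c c≤2⁻ʲ)
  k≡2^t+c : k ≡ 2 ℕ.^ t ℕ.+ c
  k≡2^t+c = dy-injective m k (2 ℕ.^ t ℕ.+ c) (trans k≡2⁻ʲ+c (trans (cong (_+ dy c m) 2⁻ʲ≡) (dy-+ m (2 ℕ.^ t) c)))
  a+b≡k+k : a ℕ.+ b ≡ k ℕ.+ k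
  a+b≡k+k = dy-midpoint a b k m mean≡k
  a+b≡2k = trans a+b≡k+k (cong (λ z → z ℕ.+ z) k≡2^t+c)
  influence = fracLex-influence-≥ m a b k
    (dy-≤⁻ m a b a≤b) (dy-≤⁻ m b (2 ℕ.^ m) (subst (dy b m ≤ℚ_) (dy-1-rescale 0 m ℕ.z≤n) b≤1)) a+b≡k+k
  c≤2^t = dy-≤⁻ m c (2 ℕ.^ t) (subst (dy c m ≤ℚ_) 2⁻ʲ≡ c≤2⁻ʲ)
  case₁ = λ a≤c → influence 1
    (subst₂ (λ u v → a ℕ.+ u ≤ v) (sym (ℕₚ.*-identityˡ _)) (sym (ℕₚ.*-identityˡ _))
      (edgesBelow-gap-a≤c t a b c (dy-≤⁻ m a c a≤c) c≤2^t a+b≡2k))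
  case₂ = λ 3c≤a a≤k/2 → influence 3 (edgesBelow-gap-3c≤a t a b c
    (dy-≤⁻ m (3 ℕ.* c) a (subst (_≤ℚ dy a m) (dy-* 3 0 c m) 3c≤a))
    (subst (2 ℕ.* a ≤_) k≡2^t+c
      (dy-≤⁻ (ℕ.suc m) (2 ℕ.* a) k (subst₂ _≤ℚ_ (dy-rescale m a 1) (½*dy k m) a≤k/2)))
    a+b≡2k)
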